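{- Let $\delta,n$ be positive integers, $q=2^\delta$, and let $Y\in[q^n]$ be fixed and known to the algorithm in advance. For any algorithm in the cell-probe model with $w$-bit cells solving the online multiplication problem with $X$ chosen uniformly at random from $[q^n]$, and any $t_0\le t_1<t_2$ in $[n]$ with $t_1-t_0+1=t_2-t_1=\ell$, $$\mathbb{E}\big[|IT(t_0,t_1,t_2)|\big]\ \ge\ \frac{\delta I_{Y,\ell}}{8w}-1.$$
   Context: $[m]=\{0,\dots,m-1\}$. $X[i]$ is the $i$th base-$q$ digit of $X$ (position $0$ least significant), $X[i..j]$ the integer written $X[j]\cdots X[i]$ in base $q$. Online multiplication with $Y$ known: at time $t\in[n]$ digit $X[t]$ arrives and the algorithm must output $Z[t]$ where $Z=X\times Y$, before the next digit arrives, using only $X[0],\dots,X[t]$ and $Y$. Cell-probe model: memory of cells of $w$ bits, each cell able to hold the address of any cell; computation free, no state between operations except memory; cost = cell reads/writes. Information transfer $IT(t_0,t_1,t_2)$: the set of cells written during time interval $[t_0,t_1]$, read at some time $t_r\in[t_1+1,t_2]$, and not written during $[t_1+1,t_r]$ before that read. With $X'=X[t_0..t_1]$, $Y'=Y[0..(2\ell-1)]$, $Z'=Z[(t_1+1)..t_2]$ ($t_1=t_0+\ell-1$, $t_2=t_1+\ell$): $Y'$ is retrorse if for any fixed values of $t_0$, of the digits of $X$ outside positions $t_0..t_1$, and of $Y[2\ell..(n-1)]$, each value of $Z'$ arises from at most four values of $X'$; $I_{Y,\ell}=\ell$ if $Y'$ is retrorse and $0$ otherwise. -}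

module Defs where

open import Data.Nat using (ℕ; zero; suc; _+_; _*_; _∸_; _^_; _≤_; _<_; NonZero)
open import Data.Nat.Properties using (m^n≢0; m*n≢0; _≟_; _≤?_)
import Data.Nat.DivMod as DM
open import Data.Fin using (Fin; toℕ)
import Data.Fin as F
open import Data.Bool using (Bool; true; false; if_then_else_; _∧_; _∨_)
open import Data.Maybe using (Maybe; just; nothing)
open import Data.List using (List; []; _∷_; _++_; map; upTo; length; filter)
open import Data.Nat.ListAction using (sum)
open import Data.Product using (_×_; _,_; proj₁; proj₂)
open import Relation.Nullary using (¬_; does)
open import Relation.Binary.PropositionalEquality using (_≡_)
open import Data.Integer using (+_)
open import Data.Rational using (ℚ; 1ℚ) renaming (_/_ to _/ℚ_; _-_ to _-ℚ_)

_÷pow_ : (X q k : ℕ) → .{{NonZero q}} → ℕ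
_÷pow_ X q k = DM._/_ X (q ^ k) {{m^n≢0 q k}}

_modpow_ : (X q k : ℕ) → .{{NonZero q}} → ℕ
_modpow_ X q k = DM._%_ X (q ^ k) {{m^n≢0 q k}}

digit : (q : ℕ) → .{{NonZero q}} → ℕ → ℕ → ℕ
digit q X i = DM._%_ (_÷pow_ X q i) q

digitF : (q : ℕ) → .{{NonZero q}} → ℕ → ℕ → Fin q
digitF q X i = DM._mod_ (_÷pow_ X q i) q

digits : (q : ℕ) → .{{NonZero q}} → ℕ → ℕ → ℕ → ℕ
digits q X i j = _modpow_ (_÷pow_ X q i) q (suc (j ∸ i))

replaceDigits : (q : ℕ) → .{{NonZero q}} → (X t0 ℓ X' : ℕ) → ℕ
replaceDigits q X t0 ℓ X' =
  _modpow_ X q t0 + X' * q ^ t0 + _÷pow_ X q (t0 + ℓ) * q ^ (t0 + ℓ)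

-- Cells hold w-bit words (Fin (2 ^ w)); every cell can hold the address
-- of any cell, so there are (at most, w.l.o.g. exactly) 2 ^ w cells,
-- addressed by words.

Word : ℕ → Set
Word w = Fin (2 ^ w)

Memory : ℕ → Set
Memory w = Word w → Word w

update : ∀ {w} → Memory w → Word w → Word w → Memory w
update {w} m a v b = if does (a F.≟ b) then v else m b

-- The probe program executed during one operation.  Computation is free
-- (arbitrary continuations); only reads and writes are recorded.  The
-- operation ends by outputting a digit.
data Prog (w : ℕ) : Set where
  output : ℕ → Prog w
  read   : Word w → (Word w → Prog w) → Prog w
  write  : Word w → Word w → Prog w → Prog w

-- An online algorithm over digit alphabet Fin q (Y is fixed and known in
-- advance, so it may be hard-wired into the initial memory and the
-- operations).  The only state kept between operations is the memory.
record Algorithm (q w : ℕ) : Set where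
  field
    initMem : Memory w
    op      : ℕ → Fin q → Prog w

record Probe (w : ℕ) : Set where
  constructor probe
  field
    time    : ℕ
    isWrite : Bool
    cell    : Word w

runProg : ∀ {w} → ℕ → Prog w → Memory w → ℕ × Memory w × List (Probe w)
runProg t (output z) m = z , m , []
runProg {w} t (read a k) m with runProg {w} t (k (m a)) m
... | z , m' , ps = z , m' , probe t false a ∷ ps
runProg {w} t (write a v p) m with runProg {w} t p (update {w} m a v)
... | z , m' , ps = z , m' , probe t true a ∷ ps

runFrom : ∀ {q w} → .{{NonZero q}} → Algorithm q w → ℕ → (t k : ℕ) → Memory w
        → List ℕ × Memory w × List (Probe w)
runFrom A X t zero m = [] , m , []
runFrom {q} A X t (suc k) m with runProg t (Algorithm.op A t (digitF q X t)) m
... | z , m' , ps with runFrom A X (suc t) k m'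
...   | zs , m'' , ps' = z ∷ zs , m'' , ps ++ ps'

run : ∀ {q w} → .{{NonZero q}} → Algorithm q w → (n X : ℕ) → List ℕ × List (Probe w)
run A n X with runFrom A X 0 n (Algorithm.initMem A)
... | zs , _ , ps = zs , ps

outputs : ∀ {q w} → .{{NonZero q}} → Algorithm q w → (n X : ℕ) → List ℕ
outputs A n X = proj₁ (run A n X)

lowDigits : (q : ℕ) → .{{NonZero q}} → (Z n : ℕ) → List ℕ
lowDigits q Z n = map (digit q Z) (upTo n)

Solves : ∀ {q w} → .{{NonZero q}} → (n Y : ℕ) → Algorithm q w → Set
Solves {q} n Y A = ∀ X → X < q ^ n → outputs A n X ≡ lowDigits q (X * Y) n

-- A cell c is in IT(t0,t1,t2) iff some read of c at a time tr ∈ [t1+1,t2]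
-- happens while the most recent write to c (before that read) occurred
-- at a time in [t0,t1]; i.e. c was written during [t0,t1] and not written
-- during [t1+1,tr] before that read.

inRange : ℕ → ℕ → ℕ → Bool
inRange a b x = does (a ≤? x) ∧ does (x ≤? b)

-- scan the probe sequence, remembering the time of the last write to c
ITscan : ∀ {w} → (t0 t1 t2 : ℕ) → Word w → Maybe ℕ → List (Probe w) → Bool
ITscan t0 t1 t2 c last [] = false
ITscan t0 t1 t2 c last (probe t true a ∷ ps) =
  ITscan t0 t1 t2 c (if does (a F.≟ c) then just t else last) ps
ITscan t0 t1 t2 c nothing (probe t false a ∷ ps) = ITscan t0 t1 t2 c nothing ps
ITscan t0 t1 t2 c (just s) (probe t false a ∷ ps) =
  (does (a F.≟ c) ∧ inRange (suc t1) t2 t ∧ inRange t0 t1 s)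
  ∨ ITscan t0 t1 t2 c (just s) ps

inIT : ∀ {w} → (t0 t1 t2 : ℕ) → List (Probe w) → Word w → Bool
inIT t0 t1 t2 ps c = ITscan t0 t1 t2 c nothing ps

sizeIT : ∀ {q w} → .{{NonZero q}} → Algorithm q w → (n X t0 t1 t2 : ℕ) → ℕ
sizeIT {w = w} A n X t0 t1 t2 =
  length (filter (λ c → inIT t0 t1 t2 (proj₂ (run A n X)) c ≟B true)
                 (Data.List.allFin (2 ^ w)))
  where
  open import Data.Bool using () renaming (_≟_ to _≟B_)

expectedIT : ∀ {q w} → .{{NonZero q}} → Algorithm q w → (n t0 t1 t2 : ℕ) → ℚ
expectedIT {q} A n t0 t1 t2 =
  (+ sum (map (λ X → sizeIT A n X t0 t1 t2) (upTo (q ^ n))))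
    /ℚ (q ^ n) where instance _ = m^n≢0 q n

-- Z' = Z[(t1+1)..t2] = Z[(t0+ℓ)..(t0+2ℓ-1)]
Z′ : (q : ℕ) → .{{NonZero q}} → (X Y t0 ℓ : ℕ) → ℕ
Z′ q X Y t0 ℓ = digits q (X * Y) (t0 + ℓ) (t0 + ℓ + ℓ ∸ 1)

Retrorse : (q : ℕ) → .{{NonZero q}} → (n ℓ Y′ : ℕ) → Set
Retrorse q n ℓ Y′ =
  ∀ t0 → t0 + 2 * ℓ ≤ n →
  ∀ Xo → Xo < q ^ n →              -- supplies the digits of X outside t0..t1
  ∀ Yh → Yh < q ^ (n ∸ 2 * ℓ) →
  ∀ z →
  length (filter (λ X′ → Z′ q (replaceDigits q Xo t0 ℓ X′) (Y′ + Yh * q ^ (2 * ℓ)) t0 ℓ ≟ z)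
                 (upTo (q ^ ℓ))) ≤ 4

-- I_{Y,ℓ} = ℓ if Y[0..2ℓ-1] is retrorse and 0 otherwise (as a relation
-- I-value q n ℓ Y I, which determines I uniquely).
data I-value (q : ℕ) .{{_ : NonZero q}} (n ℓ Y : ℕ) : ℕ → Set where
  retrorse     : Retrorse q n ℓ (digits q Y 0 (2 * ℓ ∸ 1)) → I-value q n ℓ Y ℓ
  not-retrorse : ¬ Retrorse q n ℓ (digits q Y 0 (2 * ℓ ∸ 1)) → I-value q n ℓ Y 0

pow2NZ : ∀ δ → NonZero (2 ^ δ)
pow2NZ δ = m^n≢0 2 δ

bound : (δ I w : ℕ) → .{{NonZero w}} → ℚ
bound δ I w = ((+ (δ * I)) /ℚ (8 * w)) -ℚ 1ℚ
  where instance _ = m*n≢0 8 w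

module Submission where

-- Fix the digits of X outside the window t0 .. t1. During t1+1 .. t2 the algorithm only sees cells
-- written during t0 .. t1 that it reads first, i.e. the cells of IT, and cells whose content
-- predates t0, which depends only on the fixed digits. So IT together with the contents of its
-- cells at time t1 determines the outputs Z[t1+1 .. t2], and since Y' is retrorse at most four of
-- the 2^(δℓ) windows X' share such an encoding. An encoding of size k is a string of k letters
-- over the 2^(2w) (cell, content) pairs, so fewer than 4·2^(2wm) windows have |IT| < m; for
-- m ≈ (δℓ - 3)/(2w) this is at most half of them, whence the average of |IT| is at least m/2.

open import Defs
open import Data.Bool using (Bool; true; false; if_then_else_; _∧_; _∨_)
open import Data.Bool.Properties using (∨-assoc; ∨-zeroʳ)
import Data.Bool as Bool
open import Data.Empty using (⊥-elim)
open import Data.Fin as Fin using (Fin; combine)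
open import Data.Fin.Properties using (toℕ-injective; toℕ-fromℕ<; combine-injective)
open import Data.List using (List; []; _∷_; _++_; map; length; filter; upTo; applyUpTo; allFin; concatMap)
open import Data.List.Properties
  using (++-assoc; ++-identityʳ; ∷-injective; ≡-dec; length-++; length-map; length-applyUpTo; length-tabulate; map-applyUpTo; length-upTo; map-cong)
open import Data.List.Membership.Propositional using (_∈_)
open import Data.List.Membership.Propositional.Properties
  using (∈-map⁺; ∈-map⁻; ∈-filter⁺; ∈-filter⁻; ∈-allFin; ∈-upTo⁺; ∈-upTo⁻; ∈-concatMap⁺)
open import Data.List.Relation.Unary.All as All using (All; []; _∷_)
open import Data.List.Relation.Unary.All.Properties using (++⁺)
open import Data.List.Relation.Unary.Any as Any using (here; there)
open import Data.Maybe using (Maybe; just; nothing)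
open import Data.Nat hiding (_≥_)
open import Data.Nat.DivMod
open import Data.Nat.Divisibility using (divides)
open import Data.Nat.ListAction using (sum)
open import Data.Nat.Properties
open import Data.Nat.Tactic.RingSolver using (solve-∀)
open import Data.Product using (_×_; _,_; proj₁; proj₂; Σ)
open import Data.Sum using (_⊎_; inj₁; inj₂)
open import Function using (_∘_)
open import Relation.Nullary using (Dec; does; yes; no)
open import Relation.Nullary.Decidable using (dec-true)
open import Relation.Binary.PropositionalEquality
import Data.Integer as ℤ
import Data.Integer.Properties as ℤ
import Data.Integer.Tactic.RingSolver as ℤ
import Data.Rational as ℚ
open import Data.Rational using (_≥_)
import Data.Rational.Properties as ℚ
import Data.Rational.Unnormalised as ℚᵘ
import Data.Rational.Unnormalised.Properties as ℚᵘ

-- Runs of a cell-probe algorithm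

module Cells (w : ℕ) where

  private
    variable
      B : Set

  _==_ : Word w → Word w → Bool
  a == c = does (a Fin.≟ c)

  ==-refl : (a : Word w) → (a == a) ≡ true
  ==-refl a = dec-true (a Fin.≟ a) refl

  ∨-false : ∀ x y → (x ∨ y) ≡ false → x ≡ false × y ≡ false
  ∨-false false y e = refl , e

  Outcome : Set → Set
  Outcome B = B × Memory w × List (Probe w)

  memory : Outcome B → Memory w
  memory = proj₁ ∘ proj₂

  probes : Outcome B → List (Probe w)
  probes = proj₂ ∘ proj₂

  readBeforeWrite : Word w → List (Probe w) → Bool
  readBeforeWrite c [] = false
  readBeforeWrite c (probe t true a ∷ ps) = if a == c then false else readBeforeWrite c ps
  readBeforeWrite c (probe t false a ∷ ps) = (a == c) ∨ readBeforeWrite c ps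

  writes : Word w → List (Probe w) → Bool
  writes c [] = false
  writes c (probe t true a ∷ ps) = (a == c) ∨ writes c ps
  writes c (probe t false a ∷ ps) = writes c ps

  writes-++ : (c : Word w) (xs ys : List (Probe w)) → writes c (xs ++ ys) ≡ (writes c xs ∨ writes c ys)
  writes-++ c [] ys = refl
  writes-++ c (probe t true a ∷ xs) ys =
    trans (cong ((a == c) ∨_) (writes-++ c xs ys)) (sym (∨-assoc (a == c) _ _))
  writes-++ c (probe t false a ∷ xs) ys = writes-++ c xs ys

  _≈[_]_ : Memory w → List (Probe w) → Memory w → Set
  M ≈[ ps ] D = ∀ c → readBeforeWrite c ps ≡ true → M c ≡ D c

  Agree : Outcome B → Outcome B → List (Probe w) → Set
  Agree r r' rest = proj₁ r ≡ proj₁ r' × probes r ≡ probes r' × memory r ≈[ rest ] memory r'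

  update-≈ : ∀ t ps (M D : Memory w) a v → M ≈[ probe t true a ∷ ps ] D → update {w} M a v ≈[ ps ] update {w} D a v
  update-≈ t ps M D a v M≈D c rbw with a Fin.≟ c | M≈D c
  ... | yes _ | _ = refl
  ... | no _ | Mc≡Dc = Mc≡Dc rbw

  runProg-agree : ∀ t (p : Prog w) M D rest → M ≈[ probes (runProg t p M) ++ rest ] D →
                  Agree (runProg t p M) (runProg t p D) rest
  runProg-agree t (output z) M D rest M≈D = refl , refl , M≈D
  runProg-agree t (read a k) M D rest M≈D =
    trans (proj₁ IH) (cong proj₁ answer-agrees) ,
    cong (probe t false a ∷_) (trans (proj₁ (proj₂ IH)) (cong probes answer-agrees)) ,
    subst (λ m → memory (runProg t (k (M a)) M) ≈[ rest ] m) (cong memory answer-agrees) (proj₂ (proj₂ IH))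
    where
    ps = probes (runProg t (k (M a)) M) ++ rest
    Ma≡Da : M a ≡ D a
    Ma≡Da = M≈D a (cong (_∨ readBeforeWrite a ps) (==-refl a))
    IH : Agree (runProg t (k (M a)) M) (runProg t (k (M a)) D) rest
    IH = runProg-agree t (k (M a)) M D rest
           (λ c rbw → M≈D c (trans (cong ((a == c) ∨_) rbw) (∨-zeroʳ (a == c))))
    answer-agrees : runProg t (k (M a)) D ≡ runProg t (k (D a)) D
    answer-agrees = cong (λ v → runProg t (k v) D) Ma≡Da
  runProg-agree t (write a v p) M D rest M≈D =
    proj₁ IH , cong (probe t true a ∷_) (proj₁ (proj₂ IH)) , proj₂ (proj₂ IH)
    where
    IH : Agree (runProg t p (update {w} M a v)) (runProg t p (update {w} D a v)) rest
    IH = runProg-agree t p (update {w} M a v) (update {w} D a v) rest (update-≈ t (probes (runProg {w} t p (update {w} M a v)) ++ rest) M D a v M≈D)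

  runProg-unwritten : ∀ t (p : Prog w) M c → writes c (probes (runProg t p M)) ≡ false →
                      memory (runProg t p M) c ≡ M c
  runProg-unwritten t (output z) M c _ = refl
  runProg-unwritten t (read a k) M c unwritten = runProg-unwritten t (k (M a)) M c unwritten
  runProg-unwritten t (write a v p) M c unwritten =
    trans (runProg-unwritten t p (update {w} M a v) c (proj₂ split)) (untouched (a == c) (proj₁ split))
    where
    split = ∨-false (a == c) _ unwritten
    untouched : ∀ b → b ≡ false → (if b then v else M c) ≡ M c
    untouched false _ = refl

  runProg-times : ∀ t (p : Prog w) M → All (λ x → Probe.time x ≡ t) (probes (runProg t p M))
  runProg-times t (output z) M = []
  runProg-times t (read a k) M = refl ∷ runProg-times t (k (M a)) M
  runProg-times t (write a v p) M = refl ∷ runProg-times t p (update {w} M a v)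

  During : ℕ → ℕ → Probe w → Set
  During lo hi x = lo ≤ Probe.time x × Probe.time x < hi

  _▷_ : Outcome (List ℕ) → Outcome (List ℕ) → Outcome (List ℕ)
  r ▷ r' = proj₁ r ++ proj₁ r' , memory r' , probes r ++ probes r'

module Runs {q w : ℕ} .{{_ : NonZero q}} (A : Algorithm q w) where

  open Cells w

  step : ℕ → ℕ → Prog w
  step X t = Algorithm.op A t (digitF q X t)

  runFrom-agree : ∀ X t k M D rest → M ≈[ probes (runFrom A X t k M) ++ rest ] D →
                  Agree (runFrom A X t k M) (runFrom A X t k D) rest
  runFrom-agree X t zero M D rest M≈D = refl , refl , M≈D
  runFrom-agree X t (suc k) M D rest M≈D =
    cong₂ _∷_ (proj₁ now) (proj₁ later) ,
    cong₂ _++_ (proj₁ (proj₂ now)) (proj₁ (proj₂ later)) ,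
    proj₂ (proj₂ later)
    where
    r = runProg t (step X t) M
    tail = runFrom A X (suc t) k (memory r)
    now : Agree r (runProg t (step X t) D) (probes tail ++ rest)
    now = runProg-agree t (step X t) M D (probes tail ++ rest)
            (λ c rbw → M≈D c (subst (λ ps → readBeforeWrite c ps ≡ true) (sym (++-assoc (probes r) (probes tail) rest)) rbw))
    later : Agree tail (runFrom A X (suc t) k (memory (runProg t (step X t) D))) rest
    later = runFrom-agree X (suc t) k (memory r) _ rest (proj₂ (proj₂ now))

  runFrom-unwritten : ∀ X t k M c → writes c (probes (runFrom A X t k M)) ≡ false →
                      memory (runFrom A X t k M) c ≡ M c
  runFrom-unwritten X t zero M c _ = refl
  runFrom-unwritten X t (suc k) M c unwritten =
    trans (runFrom-unwritten X (suc t) k (memory r) c (proj₂ split))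
          (runProg-unwritten t (step X t) M c (proj₁ split))
    where
    r = runProg t (step X t) M
    split = ∨-false _ _ (trans (sym (writes-++ c (probes r) _)) unwritten)

  runFrom-times : ∀ X t k M → All (During t (t + k)) (probes (runFrom A X t k M))
  runFrom-times X t zero M = []
  runFrom-times X t (suc k) M =
    ++⁺ (All.map (λ {x} → now {x}) (runProg-times t (step X t) M))
        (All.map (λ {x} → later {x}) (runFrom-times X (suc t) k (memory (runProg t (step X t) M))))
    where
    now : ∀ {x} → Probe.time x ≡ t → During t (t + suc k) x
    now refl = ≤-refl , <-≤-trans (m<m+n t {suc k} z<s) ≤-refl
    later : ∀ {x} → During (suc t) (suc t + k) x → During t (t + suc k) x
    later {x} (lo , hi) = <⇒≤ lo , subst (Probe.time x <_) (sym (+-suc t k)) hi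

  runFrom-++ : ∀ X t a b m s → s ≡ a + t →
               runFrom A X t (a + b) m ≡ runFrom A X t a m ▷ runFrom A X s b (memory (runFrom A X t a m))
  runFrom-++ X t zero b m .t refl = refl
  runFrom-++ X t (suc a) b m s s≡ =
    trans (cong (λ R → proj₁ r ∷ proj₁ R , memory R , probes r ++ probes R) IH)
          (cong (λ ps → proj₁ r ∷ proj₁ (R₁ ▷ R₂) , memory R₂ , ps) (sym (++-assoc (probes r) (probes R₁) (probes R₂))))
    where
    r = runProg t (step X t) m
    R₁ = runFrom A X (suc t) a (memory r)
    R₂ = runFrom A X s b (memory R₁)
    IH = runFrom-++ X (suc t) a b (memory r) s (trans s≡ (sym (+-suc a t)))

  runFrom-digits : ∀ X X' t k m → (∀ i → i < k → digitF q X (t + i) ≡ digitF q X' (t + i)) →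
                   runFrom A X t k m ≡ runFrom A X' t k m
  runFrom-digits X X' t zero m same = refl
  runFrom-digits X X' t (suc k) m same
    with digitF q X t | digitF q X' t | subst (λ j → digitF q X j ≡ digitF q X' j) (+-identityʳ t) (same 0 z<s)
  ... | d | .d | refl =
    cong (λ R → _ ∷ proj₁ R , memory R , _ ++ probes R)
         (runFrom-digits X X' (suc t) k _ (λ i i<k → subst (λ j → digitF q X j ≡ digitF q X' j) (+-suc t i) (same (suc i) (s<s i<k))))

  length-outputs : ∀ X t k m → length (proj₁ (runFrom A X t k m)) ≡ k
  length-outputs X t zero m = refl
  length-outputs X t (suc k) m = cong suc (length-outputs X (suc t) k _)

-- Information transfer

module Scan (w t0 t1 t2 : ℕ) (c : Word w) where

  open Cells w

  lastWrite : Maybe ℕ → List (Probe w) → Maybe ℕ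
  lastWrite st [] = st
  lastWrite st (probe t true a ∷ ps) = lastWrite (if a == c then just t else st) ps
  lastWrite st (probe t false a ∷ ps) = lastWrite st ps

  scan : Maybe ℕ → List (Probe w) → Bool
  scan = ITscan {w} t0 t1 t2 c

  scan-++ : ∀ st xs ys → scan st (xs ++ ys) ≡ (scan st xs ∨ scan (lastWrite st xs) ys)
  scan-++ st [] ys = refl
  scan-++ st (probe t true a ∷ xs) ys = scan-++ _ xs ys
  scan-++ nothing (probe t false a ∷ xs) ys = scan-++ nothing xs ys
  scan-++ (just s) (probe t false a ∷ xs) ys =
    trans (cong (_ ∨_) (scan-++ (just s) xs ys))
          (sym (∨-assoc ((a == c) ∧ inRange (suc t1) t2 t ∧ inRange t0 t1 s) _ _))

  WrittenInWindow : Maybe ℕ → Set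
  WrittenInWindow st = Σ ℕ λ s → st ≡ just s × t0 ≤ s × s ≤ t1

  lastWrite-inWindow : ∀ st xs → All (During t0 (suc t1)) xs → (writes c xs ≡ true ⊎ WrittenInWindow st) →
                       WrittenInWindow (lastWrite st xs)
  lastWrite-inWindow st [] _ (inj₂ inWindow) = inWindow
  lastWrite-inWindow st (probe t false a ∷ xs) (_ ∷ during) h = lastWrite-inWindow st xs during h
  lastWrite-inWindow st (probe t true a ∷ xs) ((lo , hi) ∷ during) h = cases (a == c) h
    where
    cases : ∀ b → ((b ∨ writes c xs) ≡ true ⊎ WrittenInWindow st) →
            WrittenInWindow (lastWrite (if b then just t else st) xs)
    cases true _ = lastWrite-inWindow (just t) xs during (inj₂ (t , refl , lo , ≤-pred hi))
    cases false h' = lastWrite-inWindow st xs during h'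

  inRange-true : ∀ {a b x} → a ≤ x → x ≤ b → inRange a b x ≡ true
  inRange-true {a} {b} {x} a≤x x≤b rewrite dec-true (a ≤? x) a≤x | dec-true (x ≤? b) x≤b = refl

  scan-read : ∀ st ys → All (During (suc t1) (suc t2)) ys → WrittenInWindow st →
              readBeforeWrite c ys ≡ true → scan st ys ≡ true
  scan-read st (probe t true a ∷ ys) (_ ∷ during) inWindow rbw = cases (a == c) rbw
    where
    cases : ∀ b → (if b then false else readBeforeWrite c ys) ≡ true → scan (if b then just t else st) ys ≡ true
    cases false rbw' = scan-read st ys during inWindow rbw'
  scan-read .(just s) (probe t false a ∷ ys) ((lo , hi) ∷ during) inWindow@(s , refl , lo' , hi') rbw =
    cases (a == c) rbw
    where
    cases : ∀ b → (b ∨ readBeforeWrite c ys) ≡ true →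
            ((b ∧ inRange (suc t1) t2 t ∧ inRange t0 t1 s) ∨ scan (just s) ys) ≡ true
    cases true _ rewrite inRange-true lo (≤-pred hi) | inRange-true lo' hi' = refl
    cases false rbw' = scan-read (just s) ys during inWindow rbw'

  scan-write-read : ∀ pre mid post rest → All (During t0 (suc t1)) mid → All (During (suc t1) (suc t2)) post →
                    writes c mid ≡ true → readBeforeWrite c post ≡ true →
                    inIT t0 t1 t2 (pre ++ (mid ++ (post ++ rest))) c ≡ true
  scan-write-read pre mid post rest mid-during post-during written firstRead =
    begin
      scan nothing (pre ++ (mid ++ (post ++ rest)))
    ≡⟨ scan-++ nothing pre _ ⟩
      scan nothing pre ∨ scan st₁ (mid ++ (post ++ rest))
    ≡⟨ cong (scan nothing pre ∨_) (scan-++ st₁ mid _) ⟩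
      scan nothing pre ∨ (scan st₁ mid ∨ scan st₂ (post ++ rest))
    ≡⟨ cong (λ b → scan nothing pre ∨ (scan st₁ mid ∨ b)) (scan-++ st₂ post rest) ⟩
      scan nothing pre ∨ (scan st₁ mid ∨ (scan st₂ post ∨ scan (lastWrite st₂ post) rest))
    ≡⟨ cong (λ b → scan nothing pre ∨ (scan st₁ mid ∨ (b ∨ scan (lastWrite st₂ post) rest))) post-hits ⟩
      scan nothing pre ∨ (scan st₁ mid ∨ true)
    ≡⟨ cong (scan nothing pre ∨_) (∨-zeroʳ _) ⟩
      scan nothing pre ∨ true
    ≡⟨ ∨-zeroʳ _ ⟩
      true
    ∎
    where
    open ≡-Reasoning
    st₁ = lastWrite nothing pre
    st₂ = lastWrite st₁ mid
    post-hits : scan st₂ post ≡ true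
    post-hits = scan-read st₂ post post-during (lastWrite-inWindow st₁ mid mid-during (inj₁ written)) firstRead

-- Base-q digits

[m+kn]/n≡m/n+k : ∀ m k n .{{_ : NonZero n}} → (m + k * n) / n ≡ m / n + k
[m+kn]/n≡m/n+k m k n = trans (+-distrib-/-∣ʳ m (divides k refl)) (cong (m / n +_) (m*n/n≡m k n))

module Digits (q : ℕ) .{{_ : NonZero q}} where

  q^≢0 : ∀ k → NonZero (q ^ k)
  q^≢0 k = m^n≢0 q k

  infixl 7 _÷q^_ _modq^_

  _÷q^_ : ℕ → ℕ → ℕ
  X ÷q^ k = _÷pow_ X q k

  _modq^_ : ℕ → ℕ → ℕ
  X modq^ k = _modpow_ X q k

  digitF-cong : ∀ {X X'} i → digit q X i ≡ digit q X' i → digitF q X i ≡ digitF q X' i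
  digitF-cong i same = toℕ-injective (trans (toℕ-fromℕ< _) (trans same (sym (toℕ-fromℕ< _))))

  ÷q^-÷q^ : ∀ X s i → (X ÷q^ s) ÷q^ i ≡ X ÷q^ (s + i)
  ÷q^-÷q^ X s i =
    trans (m/n/o≡m/[n*o] X (q ^ s) (q ^ i) {{q^≢0 s}} {{q^≢0 i}} {{q^s*q^i≢0}})
          (/-congʳ {{q^s*q^i≢0}} {{q^≢0 (s + i)}} (sym (^-distribˡ-+-* q s i)))
    where
    q^s*q^i≢0 = m*n≢0 (q ^ s) (q ^ i) {{q^≢0 s}} {{q^≢0 i}}

  digit-÷q^ : ∀ X s i → digit q (X ÷q^ s) i ≡ digit q X (s + i)
  digit-÷q^ X s i = cong (_% q) (÷q^-÷q^ X s i)

  digit-+-low : ∀ a K s i → i < s → digit q (a + K * q ^ s) i ≡ digit q a i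
  digit-+-low a K s i i<s =
    trans (cong (λ z → ((a + z) ÷q^ i) % q) K*q^s≡)
          (trans (cong (_% q) ([m+kn]/n≡m/n+k a (K * q ^ j * q) (q ^ i)))
                 ([m+kn]%n≡m%n (a ÷q^ i) (K * q ^ j) q))
    where
    instance _ = q^≢0 i
    j = s ∸ suc i
    s≡ : s ≡ suc j + i
    s≡ = trans (sym (m∸n+n≡m (<⇒≤ i<s))) (cong (_+ i) (+-∸-assoc 1 i<s))
    K*q^s≡ : K * q ^ s ≡ K * q ^ j * q * q ^ i
    K*q^s≡ = trans (cong (λ e → K * q ^ e) s≡)
             (trans (cong (K *_) (^-distribˡ-+-* q (suc j) i)) (reassoc K (q ^ j) (q ^ i) q))
      where
      reassoc : ∀ K x y q → K * ((q * x) * y) ≡ K * x * q * y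
      reassoc = solve-∀

  digit-+-high : ∀ a K s u → a < q ^ s → digit q (a + K * q ^ s) (s + u) ≡ digit q K u
  digit-+-high a K s u a<q^s =
    cong (_% q) (trans (sym (÷q^-÷q^ (a + K * q ^ s) s u))
                (cong (_÷q^ u) (trans ([m+kn]/n≡m/n+k a K (q ^ s)) (cong (_+ K) (m<n⇒m/n≡0 a<q^s)))))
    where instance _ = q^≢0 s

  modpow-suc : ∀ X k → X modq^ (suc k) ≡ X % q + ((X ÷q^ 1) modq^ k) * q
  modpow-suc X k =
    trans (%-congʳ (*-comm q (q ^ k)))
          (trans (m≡m%n+[m/n]*n R q) (cong₂ (λ x y → x + y * q) R%q R/q))
    where
    instance
      _ = q^≢0 k
      _ = q^≢0 (suc k)
      _ = q^≢0 1
      q^k*q≢0 : NonZero (q ^ k * q)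
      q^k*q≢0 = m*n≢0 (q ^ k) q
    R = X % (q ^ k * q)
    R%q : R % q ≡ X % q
    R%q = m∣n⇒o%n%m≡o%m q (q ^ k * q) X (divides (q ^ k) refl)
    R/q : R / q ≡ (X ÷q^ 1) modq^ k
    R/q = trans (m%[n*o]/o≡m/o%n X (q ^ k) q)
                (cong (_% (q ^ k)) (/-congʳ (sym (*-identityʳ q))))

  modpow-digits : ∀ k X X' → (∀ i → i < k → digit q X i ≡ digit q X' i) → X modq^ k ≡ X' modq^ k
  modpow-digits zero X X' _ = trans (n%1≡0 X) (sym (n%1≡0 X'))
  modpow-digits (suc k) X X' same =
    trans (modpow-suc X k) (trans (cong₂ (λ x y → x + y * q) low rest) (sym (modpow-suc X' k)))
    where
    low : X % q ≡ X' % q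
    low = trans (cong (_% q) (sym (n/1≡n X))) (trans (same 0 z<s) (cong (_% q) (n/1≡n X')))
    rest = modpow-digits k (X ÷q^ 1) (X' ÷q^ 1)
             (λ i i<k → trans (digit-÷q^ X 1 i) (trans (same (suc i) (s<s i<k)) (sym (digit-÷q^ X' 1 i))))

  digits-cong : ∀ X X' i j → (∀ k → k < suc (j ∸ i) → digit q X (i + k) ≡ digit q X' (i + k)) →
                digits q X i j ≡ digits q X' i j
  digits-cong X X' i j same =
    modpow-digits (suc (j ∸ i)) (X ÷q^ i) (X' ÷q^ i)
      (λ k k< → trans (digit-÷q^ X i k) (trans (same k k<) (sym (digit-÷q^ X' i k))))

  digits-+-÷q^ : ∀ X k → digits q X 0 k + (X ÷q^ (suc k)) * q ^ suc k ≡ X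
  digits-+-÷q^ X k =
    trans (cong (λ z → z modq^ (suc k) + (X ÷q^ (suc k)) * q ^ suc k) (n/1≡n X))
          (sym (m≡m%n+[m/n]*n X (q ^ suc k) {{q^≢0 (suc k)}}))

  ÷q^-< : ∀ X n k → X < q ^ n → k ≤ n → X ÷q^ k < q ^ (n ∸ k)
  ÷q^-< X n k X<q^n k≤n = m<n*o⇒m/o<n (subst (X <_) q^n≡ X<q^n)
    where
    instance _ = q^≢0 k
    q^n≡ : q ^ n ≡ q ^ (n ∸ k) * q ^ k
    q^n≡ = trans (cong (q ^_) (sym (m∸n+n≡m k≤n))) (^-distribˡ-+-* q (n ∸ k) k)

  replaceDigits-+ : ∀ a b t0 ℓ x → a < q ^ t0 →
                    replaceDigits q (a + b * q ^ (t0 + ℓ)) t0 ℓ x ≡ a + x * q ^ t0 + b * q ^ (t0 + ℓ)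
  replaceDigits-+ a b t0 ℓ x a<q^t0 = cong₂ (λ u v → u + x * q ^ t0 + v * q ^ (t0 + ℓ)) low high
    where
    instance
      _ = q^≢0 t0
      _ = q^≢0 (t0 + ℓ)
    b*q^[t0+ℓ]≡ : b * q ^ (t0 + ℓ) ≡ (b * q ^ ℓ) * q ^ t0
    b*q^[t0+ℓ]≡ = trans (cong (b *_) (trans (^-distribˡ-+-* q t0 ℓ) (*-comm (q ^ t0) (q ^ ℓ))))
                        (sym (*-assoc b (q ^ ℓ) (q ^ t0)))
    low : (a + b * q ^ (t0 + ℓ)) modq^ t0 ≡ a
    low = trans (cong (λ z → (a + z) % q ^ t0) b*q^[t0+ℓ]≡)
                (trans ([m+kn]%n≡m%n a (b * q ^ ℓ) (q ^ t0)) (m<n⇒m%n≡m a<q^t0))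
    high : (a + b * q ^ (t0 + ℓ)) ÷q^ (t0 + ℓ) ≡ b
    high = trans ([m+kn]/n≡m/n+k a b (q ^ (t0 + ℓ)))
                 (cong (_+ b) (m<n⇒m/n≡0 (<-≤-trans a<q^t0 (^-monoʳ-≤ q (m≤m+n t0 ℓ)))))

-- Finite sums, lists and counting

sumBelow : ℕ → (ℕ → ℕ) → ℕ
sumBelow zero f = 0
sumBelow (suc n) f = f 0 + sumBelow n (f ∘ suc)

sum-applyUpTo : ∀ (f g : ℕ → ℕ) n → sum (map f (applyUpTo g n)) ≡ sumBelow n (f ∘ g)
sum-applyUpTo f g zero = refl
sum-applyUpTo f g (suc n) = cong (f (g 0) +_) (sum-applyUpTo f (g ∘ suc) n)

sum-upTo : ∀ (f : ℕ → ℕ) n → sum (map f (upTo n)) ≡ sumBelow n f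
sum-upTo f = sum-applyUpTo f (λ i → i)

sumBelow-cong : ∀ n {f g} → (∀ i → i < n → f i ≡ g i) → sumBelow n f ≡ sumBelow n g
sumBelow-cong zero _ = refl
sumBelow-cong (suc n) f≡g = cong₂ _+_ (f≡g 0 z<s) (sumBelow-cong n (λ i i<n → f≡g (suc i) (s<s i<n)))

sumBelow-mono : ∀ n {f g} → (∀ i → i < n → f i ≤ g i) → sumBelow n f ≤ sumBelow n g
sumBelow-mono zero _ = z≤n
sumBelow-mono (suc n) f≤g = +-mono-≤ (f≤g 0 z<s) (sumBelow-mono n (λ i i<n → f≤g (suc i) (s<s i<n)))

sumBelow-++ : ∀ a b f → sumBelow (a + b) f ≡ sumBelow a f + sumBelow b (λ i → f (a + i))
sumBelow-++ zero b f = refl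
sumBelow-++ (suc a) b f = trans (cong (f 0 +_) (sumBelow-++ a b (f ∘ suc))) (sym (+-assoc (f 0) _ _))

sumBelow-+ : ∀ n f g → sumBelow n (λ i → f i + g i) ≡ sumBelow n f + sumBelow n g
sumBelow-+ zero f g = refl
sumBelow-+ (suc n) f g = trans (cong (f 0 + g 0 +_) (sumBelow-+ n (f ∘ suc) (g ∘ suc))) (interchange (f 0) (g 0) _ _)
  where
  interchange : ∀ a b c d → a + b + (c + d) ≡ a + c + (b + d)
  interchange = solve-∀

sumBelow-*ˡ : ∀ n c f → sumBelow n (λ i → c * f i) ≡ c * sumBelow n f
sumBelow-*ˡ zero c f = sym (*-zeroʳ c)
sumBelow-*ˡ (suc n) c f = trans (cong (c * f 0 +_) (sumBelow-*ˡ n c (f ∘ suc))) (sym (*-distribˡ-+ c (f 0) _))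

sumBelow-const : ∀ n c → sumBelow n (λ _ → c) ≡ n * c
sumBelow-const zero c = refl
sumBelow-const (suc n) c = cong (c +_) (sumBelow-const n c)

sumBelow-comm : ∀ n m (f : ℕ → ℕ → ℕ) →
                sumBelow n (λ i → sumBelow m (f i)) ≡ sumBelow m (λ j → sumBelow n (λ i → f i j))
sumBelow-comm zero m f = sym (trans (sumBelow-const m 0) (*-zeroʳ m))
sumBelow-comm (suc n) m f =
  trans (cong (sumBelow m (f 0) +_) (sumBelow-comm n m (f ∘ suc)))
        (sym (sumBelow-+ m (f 0) (λ j → sumBelow n (λ i → f (suc i) j))))

sumBelow-* : ∀ b a f → sumBelow (b * a) f ≡ sumBelow b (λ c → sumBelow a (λ i → f (c * a + i)))
sumBelow-* zero a f = refl
sumBelow-* (suc b) a f =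
  trans (sumBelow-++ a (b * a) f)
        (cong (sumBelow a f +_)
              (trans (sumBelow-* b a (λ i → f (a + i)))
                     (sumBelow-cong b (λ c _ → sumBelow-cong a (λ i _ → cong f (sym (+-assoc a (c * a) i)))))))

sumBelow-affine : ∀ n W C V G → (∀ i → i < n → C ≤ W * G i + V) → n * C ≤ W * sumBelow n G + n * V
sumBelow-affine n W C V G C≤ = begin
    n * C                                   ≡⟨ sym (sumBelow-const n C) ⟩
    sumBelow n (λ _ → C)                    ≤⟨ sumBelow-mono n C≤ ⟩
    sumBelow n (λ i → W * G i + V)          ≡⟨ sumBelow-+ n (λ i → W * G i) (λ _ → V) ⟩
    sumBelow n (λ i → W * G i) + sumBelow n (λ _ → V)
                                            ≡⟨ cong₂ _+_ (sumBelow-*ˡ n W G) (sumBelow-const n V) ⟩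
    W * sumBelow n G + n * V                ∎
  where open ≤-Reasoning

++-cancel-length : ∀ {A : Set} (xs xs' ys ys' : List A) → length xs ≡ length xs' → xs ++ ys ≡ xs' ++ ys' →
                   xs ≡ xs' × ys ≡ ys'
++-cancel-length [] [] ys ys' _ eq = refl , eq
++-cancel-length (x ∷ xs) (x' ∷ xs') ys ys' len eq =
  cong₂ _∷_ (proj₁ heads) (proj₁ tails) , proj₂ tails
  where
  heads = ∷-injective eq
  tails = ++-cancel-length xs xs' ys ys' (suc-injective len) (proj₂ heads)

applyUpTo-++ : ∀ {A : Set} (f : ℕ → A) a b → applyUpTo f (a + b) ≡ applyUpTo f a ++ applyUpTo (λ i → f (a + i)) b
applyUpTo-++ f zero b = refl
applyUpTo-++ f (suc a) b = cong (f 0 ∷_) (applyUpTo-++ (f ∘ suc) a b)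

applyUpTo-injective : ∀ {A : Set} (f g : ℕ → A) k → applyUpTo f k ≡ applyUpTo g k → ∀ i → i < k → f i ≡ g i
applyUpTo-injective f g (suc k) eq zero _ = proj₁ (∷-injective eq)
applyUpTo-injective f g (suc k) eq (suc i) (s<s i<k) = applyUpTo-injective (f ∘ suc) (g ∘ suc) k (proj₂ (∷-injective eq)) i i<k

module _ {A : Set} where

  length-concatMap : ∀ {B : Set} (f : A → List B) xs → length (concatMap f xs) ≡ sum (map (length ∘ f) xs)
  length-concatMap f [] = refl
  length-concatMap f (x ∷ xs) = trans (length-++ (f x)) (cong (length (f x) +_) (length-concatMap f xs))

  sum-map-const : ∀ (f : A → ℕ) c xs → (∀ x → f x ≡ c) → sum (map f xs) ≡ length xs * c
  sum-map-const f c [] _ = refl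
  sum-map-const f c (x ∷ xs) f≡c = cong₂ _+_ (f≡c x) (sum-map-const f c xs f≡c)

  sum-map-≤ : ∀ (f : A → ℕ) c xs → (∀ x → f x ≤ c) → sum (map f xs) ≤ length xs * c
  sum-map-≤ f c [] _ = z≤n
  sum-map-≤ f c (x ∷ xs) f≤c = +-mono-≤ (f≤c x) (sum-map-≤ f c xs f≤c)

  sum-map-+ : ∀ (f g : A → ℕ) xs → sum (map (λ v → f v + g v) xs) ≡ sum (map f xs) + sum (map g xs)
  sum-map-+ f g [] = refl
  sum-map-+ f g (x ∷ xs) = trans (cong (f x + g x +_) (sum-map-+ f g xs)) (interchange (f x) (g x) _ _)
    where
    interchange : ∀ a b c d → a + b + (c + d) ≡ a + c + (b + d)
    interchange = solve-∀

  length-filter-filter-≤ : ∀ {P Q R : A → Set} (P? : ∀ x → Dec (P x)) (Q? : ∀ x → Dec (Q x)) (R? : ∀ x → Dec (R x)) xs →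
                           (∀ x → x ∈ xs → R x → P x → Q x) →
                           length (filter P? (filter R? xs)) ≤ length (filter Q? xs)
  length-filter-filter-≤ P? Q? R? [] _ = z≤n
  length-filter-filter-≤ P? Q? R? (x ∷ xs) R⇒P⇒Q
    with length-filter-filter-≤ P? Q? R? xs (λ y y∈xs → R⇒P⇒Q y (there y∈xs)) | R? x | Q? x
  ... | IH | no _ | no _ = IH
  ... | IH | no _ | yes _ = m≤n⇒m≤1+n IH
  ... | IH | yes r | yes _ with P? x
  ...   | yes _ = s≤s IH
  ...   | no _ = m≤n⇒m≤1+n IH
  length-filter-filter-≤ P? Q? R? (x ∷ xs) R⇒P⇒Q | IH | yes r | no ¬q with P? x
  ...   | yes p = ⊥-elim (¬q (R⇒P⇒Q x (here refl) r p))
  ...   | no _ = IH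

  markov : ∀ (F : A → ℕ) m (small? : ∀ x → Dec (F x < m)) xs →
           m * length xs ≤ sum (map F xs) + m * length (filter small? xs)
  markov F m small? [] = ≤-refl
  markov F m small? (x ∷ xs) with small? x
  ... | yes _ = begin
      m * suc (length xs)        ≡⟨ *-suc m _ ⟩
      m + m * length xs          ≤⟨ +-monoʳ-≤ m (markov F m small? xs) ⟩
      m + (S + m * c)            ≤⟨ +-monoʳ-≤ m (+-monoˡ-≤ (m * c) (m≤n+m S (F x))) ⟩
      m + (F x + S + m * c)      ≡⟨ rearrange m (F x) S (m * c) ⟩
      F x + S + (m + m * c)      ≡⟨ cong (F x + S +_) (sym (*-suc m c)) ⟩
      F x + S + m * suc c        ∎
    where
    open ≤-Reasoning
    S = sum (map F xs)
    c = length (filter small? xs)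
    rearrange : ∀ a b d e → a + (b + d + e) ≡ b + d + (a + e)
    rearrange = solve-∀
  ... | no F≮m = begin
      m * suc (length xs)        ≡⟨ *-suc m _ ⟩
      m + m * length xs          ≤⟨ +-mono-≤ (≮⇒≥ F≮m) (markov F m small? xs) ⟩
      F x + (S + m * c)          ≡⟨ sym (+-assoc (F x) S _) ⟩
      F x + S + m * c            ∎
    where
    open ≤-Reasoning
    S = sum (map F xs)
    c = length (filter small? xs)

module Strings (s : ℕ) where

  strings : ℕ → List (List (Fin s))
  strings zero = [] ∷ []
  strings (suc k) = concatMap (λ a → map (a ∷_) (strings k)) (allFin s)

  strings-complete : ∀ xs → xs ∈ strings (length xs)
  strings-complete [] = here refl
  strings-complete (a ∷ xs) =
    ∈-concatMap⁺ _ (Any.map (λ where refl → ∈-map⁺ (a ∷_) (strings-complete xs)) (∈-allFin a))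

  length-strings : ∀ k → length (strings k) ≡ s ^ k
  length-strings zero = refl
  length-strings (suc k) =
    trans (length-concatMap _ (allFin s))
          (trans (sum-map-const _ (s ^ k) (allFin s) (λ a → trans (length-map (a ∷_) (strings k)) (length-strings k)))
                 (cong (_* s ^ k) (length-tabulate {n = s} (λ i → i))))

  shortStrings : ℕ → List (List (Fin s))
  shortStrings m = concatMap strings (upTo m)

  shortStrings-complete : ∀ {m} xs → length xs < m → xs ∈ shortStrings m
  shortStrings-complete xs len<m = ∈-concatMap⁺ strings (Any.map (λ where refl → strings-complete xs) (∈-upTo⁺ len<m))

  length-shortStrings : ∀ m → length (shortStrings m) ≡ sumBelow m (s ^_)
  length-shortStrings m =
    trans (length-concatMap strings (upTo m))
          (trans (cong sum (map-cong length-strings (upTo m))) (sum-upTo (s ^_) m))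

  module Encoding (e : ℕ → List (Fin s)) where

    _≟ₛ_ : (u v : List (Fin s)) → Dec (u ≡ v)
    _≟ₛ_ = ≡-dec Fin._≟_

    count : List ℕ → List (Fin s) → ℕ
    count L v = length (filter (λ x → e x ≟ₛ v) L)

    hits : ℕ → List (Fin s) → ℕ
    hits x v = if does (e x ≟ₛ v) then 1 else 0

    count-∷ : ∀ x L v → count (x ∷ L) v ≡ hits x v + count L v
    count-∷ x L v with does (e x ≟ₛ v)
    ... | true = refl
    ... | false = refl

    sum-hits : ∀ x E → e x ∈ E → 1 ≤ sum (map (hits x) E)
    sum-hits x (v ∷ E) (here refl) with e x ≟ₛ e x
    ... | yes _ = s≤s z≤n
    ... | no e≢e = ⊥-elim (e≢e refl)
    sum-hits x (v ∷ E) (there e∈E) = ≤-trans (sum-hits x E e∈E) (m≤n+m _ (hits x v))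

    length≤sum-count : ∀ L E → (∀ x → x ∈ L → e x ∈ E) → length L ≤ sum (map (count L) E)
    length≤sum-count [] E _ = z≤n
    length≤sum-count (x ∷ L) E e∈E = begin
        suc (length L)
      ≤⟨ +-mono-≤ (sum-hits x E (e∈E x (here refl))) (length≤sum-count L E (λ y y∈L → e∈E y (there y∈L))) ⟩
        sum (map (hits x) E) + sum (map (count L) E)
      ≡⟨ sym (sum-map-+ (hits x) (count L) E) ⟩
        sum (map (λ v → hits x v + count L v) E)
      ≡⟨ cong sum (map-cong (λ v → sym (count-∷ x L v)) E) ⟩
        sum (map (count (x ∷ L)) E)
      ∎
      where open ≤-Reasoning

    pigeonhole : ∀ L E c → (∀ x → x ∈ L → e x ∈ E) → (∀ v → count L v ≤ c) → length L ≤ length E * c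
    pigeonhole L E c e∈E count≤c = ≤-trans (length≤sum-count L E e∈E) (sum-map-≤ (count L) c E count≤c)

    -- Since e determines Z, each string encodes at most as many inputs as a Z-fibre holds.
    count-short≤ : ∀ N m (Z : ℕ → ℕ) →
                   (∀ z → length (filter (λ x → Z x ≟ z) (upTo N)) ≤ 4) →
                   (∀ x y → x < N → y < N → e x ≡ e y → Z x ≡ Z y) →
                   length (filter (λ x → length (e x) <? m) (upTo N)) ≤ sumBelow m (s ^_) * 4
    count-short≤ N m Z fibre≤4 e-determines-Z =
      ≤-trans (pigeonhole short (shortStrings m) 4 is-short count≤4)
              (≤-reflexive (cong (_* 4) (length-shortStrings m)))
      where
      short? : ∀ x → Dec (length (e x) < m)
      short? x = length (e x) <? m
      short = filter short? (upTo N)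
      is-short : ∀ x → x ∈ short → e x ∈ shortStrings m
      is-short x x∈short = shortStrings-complete (e x) (proj₂ (∈-filter⁻ short? {xs = upTo N} x∈short))
      count≤4 : ∀ v → count short v ≤ 4
      count≤4 v with filter (λ x → e x ≟ₛ v) short in eq
      ... | [] = z≤n
      ... | x₀ ∷ _ = subst (λ l → length l ≤ 4) eq
                       (≤-trans (length-filter-filter-≤ (λ x → e x ≟ₛ v) (λ x → Z x ≟ Z x₀) short? (upTo N) same-Z)
                                (fibre≤4 (Z x₀)))
        where
        x₀∈ = ∈-filter⁻ (λ x → e x ≟ₛ v) (subst (x₀ ∈_) (sym eq) (here refl))
        x₀<N : x₀ < N
        x₀<N = ∈-upTo⁻ (proj₁ (∈-filter⁻ short? {xs = upTo N} (proj₁ x₀∈)))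
        same-Z : ∀ x → x ∈ upTo N → length (e x) < m → e x ≡ v → Z x ≡ Z x₀
        same-Z x x∈ _ ex≡v = e-determines-Z x x₀ (∈-upTo⁻ x∈) x₀<N (trans ex≡v (sym (proj₂ x₀∈)))

    encoding-bound : ∀ N (Z : ℕ → ℕ) →
                     (∀ z → length (filter (λ x → Z x ≟ z) (upTo N)) ≤ 4) →
                     (∀ x y → x < N → y < N → e x ≡ e y → Z x ≡ Z y) →
                     ∀ m → m * N ≤ sumBelow N (length ∘ e) + m * (sumBelow m (s ^_) * 4)
    encoding-bound N Z fibre≤4 e-determines-Z m = begin
        m * N
      ≡⟨ cong (m *_) (sym (length-upTo N)) ⟩
        m * length (upTo N)
      ≤⟨ markov (length ∘ e) m (λ x → length (e x) <? m) (upTo N) ⟩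
        sum (map (length ∘ e) (upTo N)) + m * length (filter (λ x → length (e x) <? m) (upTo N))
      ≤⟨ +-mono-≤ (≤-reflexive (sum-upTo (length ∘ e) N)) (*-monoʳ-≤ m (count-short≤ N m Z fibre≤4 e-determines-Z)) ⟩
        sumBelow N (length ∘ e) + m * (sumBelow m (s ^_) * 4)
      ∎
      where open ≤-Reasoning

-- Arithmetic of the final bound

sumBelow-pow< : ∀ s → 2 ≤ s → ∀ m → sumBelow m (s ^_) < s ^ m
sumBelow-pow< s 2≤s zero = z<s
sumBelow-pow< s 2≤s (suc m) = begin
    suc (1 + sumBelow m (λ i → s * s ^ i))  ≡⟨ cong (λ z → suc (1 + z)) (sumBelow-*ˡ m s (s ^_)) ⟩
    2 + s * sumBelow m (s ^_)               ≤⟨ +-monoˡ-≤ _ 2≤s ⟩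
    s + s * sumBelow m (s ^_)               ≡⟨ sym (*-suc s _) ⟩
    s * suc (sumBelow m (s ^_))             ≤⟨ *-monoʳ-≤ s (sumBelow-pow< s 2≤s m) ⟩
    s * s ^ m                               ∎
  where open ≤-Reasoning

module Threshold (w : ℕ) (1≤w : 1 ≤ w) where

  s : ℕ
  s = 2 ^ w * 2 ^ w

  2*short≤ : ∀ m → 2 * (sumBelow m (s ^_) * 4) ≤ 2 ^ ((w + w) * m + 3)
  2*short≤ m = begin
      2 * (sumBelow m (s ^_) * 4)   ≤⟨ *-monoʳ-≤ 2 (*-monoˡ-≤ 4 (<⇒≤ (sumBelow-pow< s 2≤s m))) ⟩
      2 * (s ^ m * 4)               ≡⟨ cong (λ z → 2 * (z * 4)) s^m≡ ⟩
      2 * (2 ^ ((w + w) * m) * 4)   ≡⟨ times8 (2 ^ ((w + w) * m)) ⟩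
      2 ^ ((w + w) * m) * 2 ^ 3     ≡⟨ sym (^-distribˡ-+-* 2 ((w + w) * m) 3) ⟩
      2 ^ ((w + w) * m + 3)         ∎
    where
    open ≤-Reasoning
    2≤s : 2 ≤ s
    2≤s = *-mono-≤ {1} {2 ^ w} {2} {2 ^ w} (^-monoʳ-≤ 2 {0} {w} z≤n) (^-monoʳ-≤ 2 {1} {w} 1≤w)
    s^m≡ : s ^ m ≡ 2 ^ ((w + w) * m)
    s^m≡ = trans (cong (_^ m) (sym (^-distribˡ-+-* 2 w w))) (^-*-assoc 2 (w + w) m)
    times8 : ∀ x → 2 * (x * 4) ≡ x * 8
    times8 = solve-∀

  -- If (2w)m + 3 ≤ K, at most half of the 2^K inputs have an encoding shorter than m.
  threshold : ∀ K T m → (w + w) * m + 3 ≤ K → m * 2 ^ K ≤ T + m * (sumBelow m (s ^_) * 4) → m * 2 ^ K ≤ 2 * T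
  threshold K T m small-m hyp = +-cancelʳ-≤ (m * 2 ^ K) (m * 2 ^ K) (2 * T) (begin
      m * 2 ^ K + m * 2 ^ K         ≡⟨ cong (m * 2 ^ K +_) (sym (+-identityʳ (m * 2 ^ K))) ⟩
      2 * (m * 2 ^ K)               ≤⟨ *-monoʳ-≤ 2 hyp ⟩
      2 * (T + m * c)               ≡⟨ distribute T m c ⟩
      2 * T + m * (2 * c)           ≤⟨ +-monoʳ-≤ (2 * T) (*-monoʳ-≤ m (≤-trans (2*short≤ m) (^-monoʳ-≤ 2 small-m))) ⟩
      2 * T + m * 2 ^ K             ∎)
    where
    open ≤-Reasoning
    c = sumBelow m (s ^_) * 4
    distribute : ∀ t m c → 2 * (t + m * c) ≡ 2 * t + m * (2 * c)
    distribute = solve-∀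

  average-bound : ∀ K T → (∀ m → m * 2 ^ K ≤ T + m * (sumBelow m (s ^_) * 4)) →
                  2 ^ K * K ≤ 8 * w * T + 8 * w * 2 ^ K
  average-bound K T hyp with K ≤? 8 * w
  ... | yes K≤8w = ≤-trans (*-monoʳ-≤ (2 ^ K) K≤8w) (≤-trans (≤-reflexive (*-comm (2 ^ K) (8 * w))) (m≤n+m _ _))
  ... | no K≰8w = begin
      2 ^ K * K                                ≤⟨ *-monoʳ-≤ (2 ^ K) K≤ ⟩
      2 ^ K * (W * m + W + 2)                  ≡⟨ expand (2 ^ K) W m ⟩
      W * (m * 2 ^ K) + (W + 2) * 2 ^ K        ≤⟨ +-monoˡ-≤ _ (*-monoʳ-≤ W (threshold K T m small-m (hyp m))) ⟩
      W * (2 * T) + (W + 2) * 2 ^ K            ≤⟨ +-mono-≤ (≤-reflexive (four w T)) (*-monoˡ-≤ (2 ^ K) W+2≤8w) ⟩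
      4 * w * T + 8 * w * 2 ^ K                ≤⟨ +-monoˡ-≤ _ (*-monoˡ-≤ T (*-monoˡ-≤ w (m≤m+n 4 4))) ⟩
      8 * w * T + 8 * w * 2 ^ K                ∎
    where
    open ≤-Reasoning
    W = w + w
    instance
      W≢0 : NonZero W
      W≢0 = >-nonZero (≤-trans 1≤w (m≤m+n w w))
    m = (K ∸ 3) / W
    3≤K : 3 ≤ K
    3≤K = ≤-trans (s≤s (s≤s (s≤s z≤n))) (≤-trans (s≤s (*-monoʳ-≤ 8 1≤w)) (≰⇒> K≰8w))
    small-m : W * m + 3 ≤ K
    small-m = ≤-trans (+-monoˡ-≤ 3 (≤-trans (≤-reflexive (*-comm W m)) (m/n*n≤m (K ∸ 3) W)))
                      (≤-reflexive (m∸n+n≡m 3≤K))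
    K≤ : K ≤ W * m + W + 2
    K≤ = begin
      K                              ≡⟨ sym (m∸n+n≡m 3≤K) ⟩
      K ∸ 3 + 3                      ≡⟨ cong (_+ 3) (m≡m%n+[m/n]*n (K ∸ 3) W) ⟩
      (K ∸ 3) % W + m * W + 3        ≤⟨ +-monoˡ-≤ 3 (+-monoˡ-≤ (m * W) (<⇒≤pred (m%n<n (K ∸ 3) W))) ⟩
      pred W + m * W + 3             ≡⟨ pred-rearrange W m W≢0 ⟩
      W * m + W + 2                  ∎
      where
      pred-rearrange : ∀ a m → NonZero a → pred a + m * a + 3 ≡ a * m + a + 2
      pred-rearrange (suc v) m _ = shift v m
        where
        shift : ∀ v m → v + m * suc v + 3 ≡ suc v * m + suc v + 2
        shift = solve-∀
    expand : ∀ N a m → N * (a * m + a + 2) ≡ a * (m * N) + (a + 2) * N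
    expand = solve-∀
    four : ∀ w T → (w + w) * (2 * T) ≡ 4 * w * T
    four = solve-∀
    W+2≤8w : W + 2 ≤ 8 * w
    W+2≤8w = begin
      w + w + 2       ≤⟨ +-monoʳ-≤ (w + w) (*-monoʳ-≤ 2 1≤w) ⟩
      w + w + 2 * w   ≡⟨ four-w w ⟩
      4 * w           ≤⟨ *-monoˡ-≤ w (m≤m+n 4 4) ⟩
      8 * w           ∎
      where
      four-w : ∀ w → w + w + 2 * w ≡ 4 * w
      four-w = solve-∀

-- Cross-multiplied form of the rational inequality below, over ℤ.
quotient-bound-ℤ : ∀ K S W N → N * K ≤ W * S + W * N →
                   (ℤ.+ K ℤ.* ℤ.+ 1 ℤ.+ ℤ.- (ℤ.+ 1) ℤ.* ℤ.+ W) ℤ.* ℤ.+ N ℤ.≤ ℤ.+ S ℤ.* ℤ.+ (W * 1)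
quotient-bound-ℤ K S W N NK≤ = subst₂ ℤ._≤_ lhs rhs (ℤ.+-monoˡ-≤ (ℤ.- ℤ.+ (W * N)) (ℤ.+≤+ NK≤))
  where
  lhs-ring : ∀ (k w n : ℤ.ℤ) → n ℤ.* k ℤ.+ ℤ.- (w ℤ.* n) ≡ (k ℤ.* ℤ.+ 1 ℤ.+ ℤ.- (ℤ.+ 1) ℤ.* w) ℤ.* n
  lhs-ring = ℤ.solve-∀
  rhs-ring : ∀ (s w n : ℤ.ℤ) → (w ℤ.* s ℤ.+ w ℤ.* n) ℤ.+ ℤ.- (w ℤ.* n) ≡ s ℤ.* (w ℤ.* ℤ.+ 1)
  rhs-ring = ℤ.solve-∀
  lhs : ℤ.+ (N * K) ℤ.+ ℤ.- ℤ.+ (W * N) ≡ (ℤ.+ K ℤ.* ℤ.+ 1 ℤ.+ ℤ.- (ℤ.+ 1) ℤ.* ℤ.+ W) ℤ.* ℤ.+ N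
  lhs = trans (cong₂ (λ a b → a ℤ.+ ℤ.- b) (ℤ.pos-* N K) (ℤ.pos-* W N)) (lhs-ring (ℤ.+ K) (ℤ.+ W) (ℤ.+ N))
  rhs : ℤ.+ (W * S + W * N) ℤ.+ ℤ.- ℤ.+ (W * N) ≡ ℤ.+ S ℤ.* ℤ.+ (W * 1)
  rhs = trans (cong₂ (λ a b → a ℤ.+ ℤ.- b)
                     (trans (ℤ.pos-+ (W * S) (W * N)) (cong₂ ℤ._+_ (ℤ.pos-* W S) (ℤ.pos-* W N)))
                     (ℤ.pos-* W N))
              (trans (rhs-ring (ℤ.+ S) (ℤ.+ W) (ℤ.+ N)) (cong (ℤ.+ S ℤ.*_) (sym (ℤ.pos-* W 1))))

quotient-bound : ∀ S N K W .{{_ : NonZero N}} .{{_ : NonZero W}} → N * K ≤ W * S + W * N →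
                 (ℤ.+ K ℚ./ W) ℚ.- ℚ.1ℚ ℚ.≤ ℤ.+ S ℚ./ N
quotient-bound S (suc N) K (suc W) NK≤ =
  ℚ.toℚᵘ-cancel-≤ (ℚᵘ.≤-respˡ-≃ (ℚᵘ.≃-sym lhs) (ℚᵘ.≤-respʳ-≃ (ℚᵘ.≃-sym (ℚ.toℚᵘ-fromℚᵘ (ℚᵘ.mkℚᵘ (ℤ.+ S) N))) unnormalised))
  where
  lhs : ℚ.toℚᵘ ((ℤ.+ K ℚ./ suc W) ℚ.- ℚ.1ℚ) ℚᵘ.≃ (ℚᵘ.mkℚᵘ (ℤ.+ K) W ℚᵘ.+ ℚᵘ.mkℚᵘ (ℤ.- ℤ.+ 1) 0)
  lhs = ℚᵘ.≃-trans (ℚ.toℚᵘ-homo-+ (ℤ.+ K ℚ./ suc W) (ℚ.- ℚ.1ℚ))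
                   (ℚᵘ.+-cong (ℚ.toℚᵘ-fromℚᵘ (ℚᵘ.mkℚᵘ (ℤ.+ K) W)) (ℚ.toℚᵘ-homo‿- ℚ.1ℚ))
  unnormalised : (ℚᵘ.mkℚᵘ (ℤ.+ K) W ℚᵘ.+ ℚᵘ.mkℚᵘ (ℤ.- ℤ.+ 1) 0) ℚᵘ.≤ ℚᵘ.mkℚᵘ (ℤ.+ S) N
  unnormalised = ℚᵘ.*≤* (quotient-bound-ℤ K S (suc W) (suc N) NK≤)

-- The encoding argument

-- The run is cut into phases [0, t0), [t0, t1], [t1+1, t2] and the rest; ℓ = l + 1 is the window length.
module Transfer {q w : ℕ} .{{_ : NonZero q}} (A : Algorithm q w) (n Y : ℕ) (solves : Solves n Y A)
                (t0 t1 t2 l r : ℕ) (t1≡ : suc t1 ≡ t0 + suc l) (t2≡ : suc t2 ≡ t0 + suc l + suc l)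
                (n≡ : n ≡ t0 + (suc l + (suc l + r))) where

  open Cells w
  open Runs A
  open Digits q

  ℓ : ℕ
  ℓ = suc l

  start : Memory w
  start = Algorithm.initMem A

  prefix writing reading suffix : ℕ → Outcome (List ℕ)
  prefix X = runFrom A X 0 t0 start
  writing X = runFrom A X t0 ℓ (memory (prefix X))
  reading X = runFrom A X (t0 + ℓ) ℓ (memory (writing X))
  suffix X = runFrom A X (t0 + ℓ + ℓ) r (memory (reading X))

  phases : ∀ X → runFrom A X 0 n start ≡ prefix X ▷ (writing X ▷ (reading X ▷ suffix X))
  phases X =
    trans (cong (λ k → runFrom A X 0 k start) n≡)
    (trans (runFrom-++ X 0 t0 (ℓ + (ℓ + r)) start t0 (sym (+-identityʳ t0)))
    (trans (cong (prefix X ▷_) (runFrom-++ X t0 ℓ (ℓ + r) _ (t0 + ℓ) (+-comm t0 ℓ)))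
           (cong (λ R → prefix X ▷ (writing X ▷ R)) (runFrom-++ X (t0 + ℓ) ℓ r _ (t0 + ℓ + ℓ) (+-comm (t0 + ℓ) ℓ)))))

  inITof : ℕ → Word w → Bool
  inITof X = inIT t0 t1 t2 (proj₂ (run A n X))

  written-then-read⇒inIT : ∀ X c → writes c (probes (writing X)) ≡ true → readBeforeWrite c (probes (reading X)) ≡ true →
                           inITof X c ≡ true
  written-then-read⇒inIT X c written firstRead =
    trans (cong (ITscan t0 t1 t2 c nothing) (cong probes (phases X)))
          (Scan.scan-write-read w t0 t1 t2 c (probes (prefix X)) (probes (writing X)) (probes (reading X)) (probes (suffix X))
             (subst (λ hi → All (During t0 hi) (probes (writing X))) (sym t1≡) (runFrom-times X t0 ℓ _))
             (subst₂ (λ lo hi → All (During lo hi) (probes (reading X))) (sym t1≡) (sym t2≡) (runFrom-times X (t0 + ℓ) ℓ _))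
             written firstRead)

  reconstructed : ℕ → Memory w
  reconstructed X c = if inITof X c then memory (writing X) c else memory (prefix X) c

  -- A cell outside IT that the read phase reads first was not written in the write phase.
  writing≈reconstructed : ∀ X → memory (writing X) ≈[ probes (reading X) ++ [] ] reconstructed X
  writing≈reconstructed X c rbw with inITof X c in c∈IT
  ... | true = refl
  ... | false with writes c (probes (writing X)) in written
  ...   | false = runFrom-unwritten X t0 ℓ _ c written
  ...   | true with () ← trans (sym (written-then-read⇒inIT X c written (subst (λ ps → readBeforeWrite c ps ≡ true) (++-identityʳ (probes (reading X))) rbw))) c∈IT

  -- The cells of IT with their contents at time t1, each pair packed into one letter.
  encoding : ℕ → List (Fin (2 ^ w * 2 ^ w))
  encoding X = map (λ c → combine c (memory (writing X) c)) (filter (λ c → inITof X c Bool.≟ true) (allFin (2 ^ w)))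

  length-encoding : ∀ X → length (encoding X) ≡ sizeIT A n X t0 t1 t2
  length-encoding X = length-map _ (filter (λ c → inITof X c Bool.≟ true) (allFin (2 ^ w)))

  encoding-inIT : ∀ X X' c → encoding X ≡ encoding X' → inITof X c ≡ true →
                  inITof X' c ≡ true × memory (writing X) c ≡ memory (writing X') c
  encoding-inIT X X' c same c∈IT with ∈-map⁻ _ (subst (combine c (memory (writing X) c) ∈_) same
                                        (∈-map⁺ _ (∈-filter⁺ (λ c → inITof X c Bool.≟ true) (∈-allFin c) c∈IT)))
  ... | c' , c'∈ , packed≡ with combine-injective c (memory (writing X) c) c' (memory (writing X') c') packed≡
  ... | refl , contents≡ = proj₂ (∈-filter⁻ (λ c → inITof X' c Bool.≟ true) {xs = allFin (2 ^ w)} c'∈) , contents≡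

  encoding-reconstructs : ∀ X X' → (∀ c → memory (prefix X) c ≡ memory (prefix X') c) → encoding X ≡ encoding X' →
                          ∀ c → reconstructed X c ≡ reconstructed X' c
  encoding-reconstructs X X' same-prefix same c with inITof X c in c∈IT | inITof X' c in c∈IT'
  ... | true | true = proj₂ (encoding-inIT X X' c same c∈IT)
  ... | true | false with () ← trans (sym (proj₁ (encoding-inIT X X' c same c∈IT))) c∈IT'
  ... | false | true with () ← trans (sym (proj₁ (encoding-inIT X' X c (sym same) c∈IT'))) c∈IT
  ... | false | false = same-prefix c

  reading-outputs : ∀ X → X < q ^ n → proj₁ (reading X) ≡ applyUpTo (λ i → digit q (X * Y) (t0 + (ℓ + i))) ℓ
  reading-outputs X X<q^n =
    proj₁ (peel (reading X) (λ i → Z (t0 + (ℓ + i))) ℓ (length-outputs X (t0 + ℓ) ℓ _)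
      (proj₂ (peel (writing X) (λ i → Z (t0 + i)) ℓ (length-outputs X t0 ℓ _)
        (proj₂ (peel (prefix X) Z t0 (length-outputs X 0 t0 start) outputs≡)))))
    where
    Z = digit q (X * Y)
    peel : ∀ (R : Outcome (List ℕ)) f k {ys ys'} → length (proj₁ R) ≡ k → proj₁ R ++ ys ≡ applyUpTo f k ++ ys' →
           proj₁ R ≡ applyUpTo f k × ys ≡ ys'
    peel R f k len eq = ++-cancel-length _ _ _ _ (trans len (sym (length-applyUpTo f k))) eq
    outputs≡ : proj₁ (prefix X) ++ (proj₁ (writing X) ++ (proj₁ (reading X) ++ proj₁ (suffix X))) ≡
               applyUpTo Z t0 ++ (applyUpTo (λ i → Z (t0 + i)) ℓ ++ (applyUpTo (λ i → Z (t0 + (ℓ + i))) ℓ ++ applyUpTo (λ i → Z (t0 + (ℓ + (ℓ + i)))) r))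
    outputs≡ = begin
        proj₁ (prefix X ▷ (writing X ▷ (reading X ▷ suffix X)))
      ≡⟨ cong proj₁ (sym (phases X)) ⟩
        outputs A n X
      ≡⟨ solves X X<q^n ⟩
        map Z (upTo n)
      ≡⟨ map-applyUpTo (λ i → i) Z n ⟩
        applyUpTo Z n
      ≡⟨ cong (applyUpTo Z) n≡ ⟩
        applyUpTo Z (t0 + (ℓ + (ℓ + r)))
      ≡⟨ applyUpTo-++ Z t0 (ℓ + (ℓ + r)) ⟩
        applyUpTo Z t0 ++ applyUpTo (λ i → Z (t0 + i)) (ℓ + (ℓ + r))
      ≡⟨ cong (applyUpTo Z t0 ++_) (applyUpTo-++ (λ i → Z (t0 + i)) ℓ (ℓ + r)) ⟩
        applyUpTo Z t0 ++ (applyUpTo (λ i → Z (t0 + i)) ℓ ++ applyUpTo (λ i → Z (t0 + (ℓ + i))) (ℓ + r))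
      ≡⟨ cong (λ zs → applyUpTo Z t0 ++ (applyUpTo (λ i → Z (t0 + i)) ℓ ++ zs)) (applyUpTo-++ (λ i → Z (t0 + (ℓ + i))) ℓ r) ⟩
        applyUpTo Z t0 ++ (applyUpTo (λ i → Z (t0 + i)) ℓ ++ (applyUpTo (λ i → Z (t0 + (ℓ + i))) ℓ ++ applyUpTo (λ i → Z (t0 + (ℓ + (ℓ + i)))) r))
      ∎
      where open ≡-Reasoning

  reading-outputs-determined : ∀ X X' →
    (∀ i → i < t0 → digit q X i ≡ digit q X' i) →
    (∀ i → i < ℓ → digit q X (t0 + ℓ + i) ≡ digit q X' (t0 + ℓ + i)) →
    encoding X ≡ encoding X' → proj₁ (reading X) ≡ proj₁ (reading X')
  reading-outputs-determined X X' same-low same-high same-encoding =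
    begin
      proj₁ (reading X)
    ≡⟨ proj₁ (runFrom-agree X (t0 + ℓ) ℓ _ (reconstructed X) [] (writing≈reconstructed X)) ⟩
      proj₁ (runFrom A X (t0 + ℓ) ℓ (reconstructed X))
    ≡⟨ cong proj₁ (runFrom-digits X X' (t0 + ℓ) ℓ _ (λ i i<ℓ → digitF-cong (t0 + ℓ + i) (same-high i i<ℓ))) ⟩
      proj₁ (runFrom A X' (t0 + ℓ) ℓ (reconstructed X))
    ≡⟨ proj₁ (runFrom-agree X' (t0 + ℓ) ℓ _ (reconstructed X') [] (λ c _ → same-reconstruction c)) ⟩
      proj₁ (runFrom A X' (t0 + ℓ) ℓ (reconstructed X'))
    ≡⟨ sym (proj₁ (runFrom-agree X' (t0 + ℓ) ℓ _ (reconstructed X') [] (writing≈reconstructed X'))) ⟩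
      proj₁ (reading X')
    ∎
    where
    open ≡-Reasoning
    same-prefix : prefix X ≡ prefix X'
    same-prefix = runFrom-digits X X' 0 t0 start (λ i i<t0 → digitF-cong i (same-low i i<t0))
    same-reconstruction : ∀ c → reconstructed X c ≡ reconstructed X' c
    same-reconstruction = encoding-reconstructs X X' (λ c → cong (λ R → memory R c) same-prefix) same-encoding

  Z′-determined : ∀ X X' → X < q ^ n → X' < q ^ n →
    (∀ i → i < t0 → digit q X i ≡ digit q X' i) →
    (∀ i → i < ℓ → digit q X (t0 + ℓ + i) ≡ digit q X' (t0 + ℓ + i)) →
    encoding X ≡ encoding X' → Z′ q X Y t0 ℓ ≡ Z′ q X' Y t0 ℓ
  Z′-determined X X' X<q^n X'<q^n same-low same-high same-encoding =
    digits-cong (X * Y) (X' * Y) (t0 + ℓ) (t0 + ℓ + ℓ ∸ 1) λ i i< →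
      subst (λ j → digit q (X * Y) j ≡ digit q (X' * Y) j) (sym (+-assoc t0 ℓ i))
        (applyUpTo-injective (λ i → digit q (X * Y) (t0 + (ℓ + i))) (λ i → digit q (X' * Y) (t0 + (ℓ + i))) ℓ same-outputs i (subst (i <_) window i<))
    where
    same-outputs = trans (sym (reading-outputs X X<q^n))
                         (trans (reading-outputs-determined X X' same-low same-high same-encoding) (reading-outputs X' X'<q^n))
    window : suc ((t0 + ℓ + ℓ ∸ 1) ∸ (t0 + ℓ)) ≡ ℓ
    window = cong suc (trans (cong (λ k → (k ∸ 1) ∸ (t0 + ℓ)) (+-suc (t0 + ℓ) l)) (m+n∸m≡n (t0 + ℓ) l))

  q^n≡ : q ^ n ≡ q ^ (t0 + ℓ) * q ^ (ℓ + r)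
  q^n≡ = trans (cong (q ^_) (trans n≡ (sym (+-assoc t0 ℓ (ℓ + r))))) (^-distribˡ-+-* q (t0 + ℓ) (ℓ + r))

  q^n≡classes : q ^ n ≡ q ^ (ℓ + r) * q ^ ℓ * q ^ t0
  q^n≡classes = trans q^n≡ (trans (cong (_* q ^ (ℓ + r)) (^-distribˡ-+-* q t0 ℓ)) (reverse (q ^ t0) (q ^ ℓ) (q ^ (ℓ + r))))
    where
    reverse : ∀ a b c → a * b * c ≡ c * b * a
    reverse = solve-∀

  -- Inputs are grouped into classes by their digits outside the window t0 .. t1: the class of
  -- (b, a) consists of the numbers (b q^ℓ + x) q^t0 + a with x < q^ℓ.
  classSum : ℕ → ℕ → ℕ
  classSum b a = sumBelow (q ^ ℓ) (λ x → sizeIT A n ((b * q ^ ℓ + x) * q ^ t0 + a) t0 t1 t2)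

  module Class (Y<q^n : Y < q ^ n) (Y′-retrorse : Retrorse q n ℓ (digits q Y 0 (2 * ℓ ∸ 1)))
               (b a : ℕ) (b<q^[ℓ+r] : b < q ^ (ℓ + r)) (a<q^t0 : a < q ^ t0) where

    outside : ℕ
    outside = a + b * q ^ (t0 + ℓ)

    input : ℕ → ℕ
    input x = replaceDigits q outside t0 ℓ x

    input≡ : ∀ x → input x ≡ a + x * q ^ t0 + b * q ^ (t0 + ℓ)
    input≡ x = replaceDigits-+ a b t0 ℓ x a<q^t0

    input≡low : ∀ x → input x ≡ a + (x + b * q ^ ℓ) * q ^ t0
    input≡low x = trans (input≡ x) (trans (cong (λ z → a + x * q ^ t0 + b * z) (^-distribˡ-+-* q t0 ℓ)) (regroup a x b (q ^ t0) (q ^ ℓ)))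
      where
      regroup : ∀ a x b u v → a + x * u + b * (u * v) ≡ a + (x + b * v) * u
      regroup = solve-∀

    input≡class : ∀ x → input x ≡ (b * q ^ ℓ + x) * q ^ t0 + a
    input≡class x = trans (input≡low x) (regroup a x b (q ^ t0) (q ^ ℓ))
      where
      regroup : ∀ a x b u v → a + (x + b * v) * u ≡ (b * v + x) * u + a
      regroup = solve-∀

    window< : ∀ x → x < q ^ ℓ → a + x * q ^ t0 < q ^ (t0 + ℓ)
    window< x x<q^ℓ = begin-strict
        a + x * q ^ t0     <⟨ +-monoˡ-< (x * q ^ t0) a<q^t0 ⟩
        suc x * q ^ t0     ≤⟨ *-monoˡ-≤ (q ^ t0) x<q^ℓ ⟩
        q ^ ℓ * q ^ t0     ≡⟨ *-comm (q ^ ℓ) (q ^ t0) ⟩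
        q ^ t0 * q ^ ℓ     ≡⟨ sym (^-distribˡ-+-* q t0 ℓ) ⟩
        q ^ (t0 + ℓ)       ∎
      where open ≤-Reasoning

    with-outside< : ∀ c → c < q ^ (t0 + ℓ) → c + b * q ^ (t0 + ℓ) < q ^ n
    with-outside< c c< = begin-strict
        c + b * q ^ (t0 + ℓ)           <⟨ +-monoˡ-< (b * q ^ (t0 + ℓ)) c< ⟩
        suc b * q ^ (t0 + ℓ)           ≤⟨ *-monoˡ-≤ (q ^ (t0 + ℓ)) b<q^[ℓ+r] ⟩
        q ^ (ℓ + r) * q ^ (t0 + ℓ)     ≡⟨ *-comm (q ^ (ℓ + r)) (q ^ (t0 + ℓ)) ⟩
        q ^ (t0 + ℓ) * q ^ (ℓ + r)     ≡⟨ sym q^n≡ ⟩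
        q ^ n                          ∎
      where open ≤-Reasoning

    input< : ∀ x → x < q ^ ℓ → input x < q ^ n
    input< x x<q^ℓ = subst (_< q ^ n) (sym (input≡ x)) (with-outside< _ (window< x x<q^ℓ))

    same-low : ∀ x y i → i < t0 → digit q (input x) i ≡ digit q (input y) i
    same-low x y i i<t0 =
      trans (cong (λ z → digit q z i) (input≡low x))
            (trans (digit-+-low a (x + b * q ^ ℓ) t0 i i<t0)
                   (sym (trans (cong (λ z → digit q z i) (input≡low y)) (digit-+-low a (y + b * q ^ ℓ) t0 i i<t0))))

    same-high : ∀ x y → x < q ^ ℓ → y < q ^ ℓ → ∀ i → i < ℓ → digit q (input x) (t0 + ℓ + i) ≡ digit q (input y) (t0 + ℓ + i)
    same-high x y x< y< i _ =
      trans (cong (λ z → digit q z (t0 + ℓ + i)) (input≡ x))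
            (trans (digit-+-high (a + x * q ^ t0) b (t0 + ℓ) i (window< x x<))
                   (sym (trans (cong (λ z → digit q z (t0 + ℓ + i)) (input≡ y)) (digit-+-high (a + y * q ^ t0) b (t0 + ℓ) i (window< y y<)))))

    Z′-of : ℕ → ℕ
    Z′-of x = Z′ q (input x) Y t0 ℓ

    -- Retrorse speaks of Y′ + Yh q^(2ℓ) for the high part Yh of Y, which recombines into Y.
    fibre≤4 : ∀ z → length (filter (λ x → Z′-of x ≟ z) (upTo (q ^ ℓ))) ≤ 4
    fibre≤4 = subst (λ Y → ∀ z → length (filter (λ x → Z′ q (input x) Y t0 ℓ ≟ z) (upTo (q ^ ℓ))) ≤ 4)
                    (digits-+-÷q^ Y (2 * ℓ ∸ 1))
                    (Y′-retrorse t0 t0+2ℓ≤n outside (with-outside< a (<-≤-trans a<q^t0 (^-monoʳ-≤ q (m≤m+n t0 ℓ))))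
                              (Y ÷q^ (2 * ℓ)) (÷q^-< Y n (2 * ℓ) Y<q^n (≤-trans (m≤n+m (2 * ℓ) t0) t0+2ℓ≤n)))
      where
      t0+2ℓ≤n : t0 + 2 * ℓ ≤ n
      t0+2ℓ≤n = subst (t0 + 2 * ℓ ≤_) (sym n≡) (+-monoʳ-≤ t0 (+-monoʳ-≤ ℓ (≤-trans (≤-reflexive (+-identityʳ ℓ)) (m≤m+n ℓ r))))

    class-bound : ∀ m → m * q ^ ℓ ≤ classSum b a + m * (sumBelow m ((2 ^ w * 2 ^ w) ^_) * 4)
    class-bound m = subst (λ T → m * q ^ ℓ ≤ T + m * (sumBelow m ((2 ^ w * 2 ^ w) ^_) * 4)) lengths≡
      (Strings.Encoding.encoding-bound (2 ^ w * 2 ^ w) (encoding ∘ input) (q ^ ℓ) Z′-of fibre≤4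
         (λ x y x< y< → Z′-determined (input x) (input y) (input< x x<) (input< y y<) (same-low x y) (same-high x y x< y<))
         m)
      where
      lengths≡ : sumBelow (q ^ ℓ) (length ∘ encoding ∘ input) ≡ classSum b a
      lengths≡ = sumBelow-cong (q ^ ℓ) (λ x _ → trans (length-encoding (input x)) (cong (λ X → sizeIT A n X t0 t1 t2) (input≡class x)))

  sum-sizeIT≡ : sum (map (λ X → sizeIT A n X t0 t1 t2) (upTo (q ^ n))) ≡ sumBelow (q ^ (ℓ + r)) (λ b → sumBelow (q ^ t0) (classSum b))
  sum-sizeIT≡ = begin
      sum (map size (upTo (q ^ n)))
    ≡⟨ sum-upTo size (q ^ n) ⟩
      sumBelow (q ^ n) size
    ≡⟨ cong (λ N → sumBelow N size) q^n≡classes ⟩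
      sumBelow (q ^ (ℓ + r) * q ^ ℓ * q ^ t0) size
    ≡⟨ sumBelow-* (q ^ (ℓ + r) * q ^ ℓ) (q ^ t0) size ⟩
      sumBelow (q ^ (ℓ + r) * q ^ ℓ) (λ c → sumBelow (q ^ t0) (λ a → size (c * q ^ t0 + a)))
    ≡⟨ sumBelow-* (q ^ (ℓ + r)) (q ^ ℓ) (λ c → sumBelow (q ^ t0) (λ a → size (c * q ^ t0 + a))) ⟩
      sumBelow (q ^ (ℓ + r)) (λ b → sumBelow (q ^ ℓ) (λ x → sumBelow (q ^ t0) (λ a → size ((b * q ^ ℓ + x) * q ^ t0 + a))))
    ≡⟨ sumBelow-cong (q ^ (ℓ + r)) (λ b _ → sumBelow-comm (q ^ ℓ) (q ^ t0) (λ x a → size ((b * q ^ ℓ + x) * q ^ t0 + a))) ⟩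
      sumBelow (q ^ (ℓ + r)) (λ b → sumBelow (q ^ t0) (classSum b))
    ∎
    where
    open ≡-Reasoning
    size = λ X → sizeIT A n X t0 t1 t2

  total-bound : ∀ K W → (∀ b a → b < q ^ (ℓ + r) → a < q ^ t0 → q ^ ℓ * K ≤ W * classSum b a + W * q ^ ℓ) →
                q ^ n * K ≤ W * sum (map (λ X → sizeIT A n X t0 t1 t2) (upTo (q ^ n))) + W * q ^ n
  total-bound K W class≤ = subst₂ _≤_ lhs rhs
    (sumBelow-affine (q ^ (ℓ + r)) W (q ^ t0 * (q ^ ℓ * K)) (q ^ t0 * (W * q ^ ℓ)) (λ b → sumBelow (q ^ t0) (classSum b))
       (λ b b< → sumBelow-affine (q ^ t0) W (q ^ ℓ * K) (W * q ^ ℓ) (classSum b) (λ a a< → class≤ b a b< a<)))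
    where
    lhs : q ^ (ℓ + r) * (q ^ t0 * (q ^ ℓ * K)) ≡ q ^ n * K
    lhs = trans (shuffle (q ^ (ℓ + r)) (q ^ t0) (q ^ ℓ) K) (cong (_* K) (sym q^n≡classes))
      where
      shuffle : ∀ a b c d → a * (b * (c * d)) ≡ a * c * b * d
      shuffle = solve-∀
    rhs : W * sumBelow (q ^ (ℓ + r)) (λ b → sumBelow (q ^ t0) (classSum b)) + q ^ (ℓ + r) * (q ^ t0 * (W * q ^ ℓ)) ≡
          W * sum (map (λ X → sizeIT A n X t0 t1 t2) (upTo (q ^ n))) + W * q ^ n
    rhs = cong₂ _+_ (cong (W *_) (sym sum-sizeIT≡))
                    (trans (shuffle (q ^ (ℓ + r)) (q ^ t0) W (q ^ ℓ)) (cong (W *_) (sym q^n≡classes)))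
      where
      shuffle : ∀ a b c d → a * (b * (c * d)) ≡ c * (a * d * b)
      shuffle = solve-∀

window-equations : ∀ {n t0 t1 t2} → t0 ≤ t1 → t1 < t2 → t2 < n → t2 ∸ t1 ≡ suc (t1 ∸ t0) →
                   let ℓ = suc (t1 ∸ t0) in
                   suc t1 ≡ t0 + ℓ × suc t2 ≡ t0 + ℓ + ℓ × n ≡ t0 + (ℓ + (ℓ + (n ∸ suc t2)))
window-equations {n} {t0} {t1} {t2} t0≤t1 t1<t2 t2<n t2∸t1≡ℓ = t1≡ , t2≡ , n≡
  where
  ℓ = suc (t1 ∸ t0)
  t1≡ : suc t1 ≡ t0 + ℓ
  t1≡ = trans (cong suc (sym (m+[n∸m]≡n t0≤t1))) (sym (+-suc t0 (t1 ∸ t0)))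
  t2≡ : suc t2 ≡ t0 + ℓ + ℓ
  t2≡ = trans (cong suc (trans (sym (m+[n∸m]≡n (<⇒≤ t1<t2))) (cong (t1 +_) t2∸t1≡ℓ))) (cong (_+ ℓ) t1≡)
  n≡ : n ≡ t0 + (ℓ + (ℓ + (n ∸ suc t2)))
  n≡ = trans (sym (m+[n∸m]≡n t2<n))
             (trans (cong (_+ (n ∸ suc t2)) t2≡) (trans (+-assoc (t0 + ℓ) ℓ _) (+-assoc t0 ℓ (ℓ + _))))

information-transfer-bound :
  ∀ δ w → 1 ≤ w → (A : Algorithm (2 ^ δ) w) (n Y : ℕ) → Y < (2 ^ δ) ^ n → Solves {{pow2NZ δ}} n Y A →
  ∀ t0 t1 t2 l r → suc t1 ≡ t0 + suc l → suc t2 ≡ t0 + suc l + suc l → n ≡ t0 + (suc l + (suc l + r)) →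
  Retrorse (2 ^ δ) {{pow2NZ δ}} n (suc l) (digits (2 ^ δ) {{pow2NZ δ}} Y 0 (2 * suc l ∸ 1)) →
  (2 ^ δ) ^ n * (δ * suc l) ≤ 8 * w * sum (map (λ X → sizeIT {{pow2NZ δ}} A n X t0 t1 t2) (upTo ((2 ^ δ) ^ n))) + 8 * w * (2 ^ δ) ^ n
information-transfer-bound δ w 1≤w A n Y Y<q^n solves t0 t1 t2 l r t1≡ t2≡ n≡ Y′-retrorse =
  total-bound K (8 * w) λ b a b< a< →
    subst (λ N → N * K ≤ 8 * w * classSum b a + 8 * w * N) (sym q^ℓ≡2^K)
      (Threshold.average-bound w 1≤w K (classSum b a)
         (subst (λ N → ∀ m → m * N ≤ classSum b a + m * _) q^ℓ≡2^K (Class.class-bound Y<q^n Y′-retrorse b a b< a<)))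
  where
  instance _ = pow2NZ δ
  open Transfer A n Y solves t0 t1 t2 l r t1≡ t2≡ n≡
  K = δ * suc l
  q^ℓ≡2^K : (2 ^ δ) ^ suc l ≡ 2 ^ K
  q^ℓ≡2^K = ^-*-assoc 2 δ (suc l)

corollary2 : (δ n : ℕ) → .{{_ : NonZero δ}} → .{{_ : NonZero n}} →
    (Y : ℕ) → Y < (2 ^ δ) ^ n →
    (w : ℕ) → .{{_ : NonZero w}} →
    (A : Algorithm (2 ^ δ) w) → Solves {{pow2NZ δ}} n Y A →
    (t0 t1 t2 ℓ : ℕ) → t0 ≤ t1 → t1 < t2 → t2 < n →
    suc (t1 ∸ t0) ≡ ℓ → t2 ∸ t1 ≡ ℓ →
    (I : ℕ) → I-value (2 ^ δ) {{pow2NZ δ}} n ℓ Y I →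
    expectedIT {{pow2NZ δ}} A n t0 t1 t2 ≥ bound δ I w
corollary2 δ n Y Y<q^n w A solves t0 t1 t2 ℓ t0≤t1 t1<t2 t2<n refl t2∸t1≡ℓ I I-val =
  quotient-bound S ((2 ^ δ) ^ n) (δ * I) (8 * w) {{m^n≢0 (2 ^ δ) n {{pow2NZ δ}}}} {{m*n≢0 8 w}} (transfer I-val)
  where
  S = sum (map (λ X → sizeIT {{pow2NZ δ}} A n X t0 t1 t2) (upTo ((2 ^ δ) ^ n)))
  transfer : ∀ {I} → I-value (2 ^ δ) {{pow2NZ δ}} n ℓ Y I → (2 ^ δ) ^ n * (δ * I) ≤ 8 * w * S + 8 * w * (2 ^ δ) ^ n
  transfer (retrorse R) with window-equations {n} t0≤t1 t1<t2 t2<n t2∸t1≡ℓ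
  ... | t1≡ , t2≡ , n≡ =
    information-transfer-bound δ w (>-nonZero⁻¹ w) A n Y Y<q^n solves t0 t1 t2 (t1 ∸ t0) (n ∸ suc t2) t1≡ t2≡ n≡ R
  transfer (not-retrorse _) = ≤-trans (≤-reflexive (trans (cong ((2 ^ δ) ^ n *_) (*-zeroʳ δ)) (*-zeroʳ ((2 ^ δ) ^ n)))) z≤n
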